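{- Let $A$ be a finite alphabet, let $\alpha\in A$ be a letter, and let $w, w'$ be recurrent infinite words over $A$ such that $w = L_\alpha(w')$ or $w = R_\alpha(w')$. Then $w$ verifies Property $\mathcal{P}$ if and only if $w'$ verifies Property $\mathcal{P}$.
   Context: An infinite word is recurrent if each of its factors occurs infinitely often. An infinite word $w$ over $A$ verifies Property $\mathcal{P}$ if for every finite word $u$ over $A$ and all letters $a,b,c,d\in A$, whenever $aub$ and $cud$ are both factors of $w$, we have $\{a,b\}\cap\{c,d\}\neq\emptyset$. For a letter $\alpha$, $L_\alpha$ and $R_\alpha$ are the morphisms with $L_\alpha(\alpha)=R_\alpha(\alpha)=\alpha$, $L_\alpha(x)=\alpha x$ and $R_\alpha(x)=x\alpha$ for letters $x\neq \alpha$ (extended to infinite words). -}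

module Defs where

open import Data.Nat using (ℕ; zero; suc; _+_; _≤_)
open import Data.Fin using (Fin; _≟_)
open import Data.List using (List; []; _∷_; _++_; [_]; length; concatMap)
open import Data.Product using (∃; _×_; _,_)
open import Data.Sum using (_⊎_)
open import Relation.Binary.PropositionalEquality using (_≡_)
open import Relation.Nullary using (yes; no)

Alphabet : ℕ → Set
Alphabet k = Fin k

InfWord : Set → Set
InfWord A = ℕ → A

take : {A : Set} → ℕ → InfWord A → List A
take zero    w = []
take (suc n) w = w 0 ∷ take n (λ i → w (suc i))

dropW : {A : Set} → ℕ → InfWord A → InfWord A
dropW i w = λ k → w (i + k)

OccursAt : {A : Set} → List A → InfWord A → ℕ → Set
OccursAt u w i = take (length u) (dropW i w) ≡ u

Factor : {A : Set} → List A → InfWord A → Set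
Factor u w = ∃ λ i → OccursAt u w i

Recurrent : {A : Set} → InfWord A → Set
Recurrent w = ∀ u → Factor u w → ∀ N → ∃ λ i → (N ≤ i) × OccursAt u w i

PropertyP : {A : Set} → InfWord A → Set
PropertyP {A} w = (u : List A) (a b c d : A) →
  Factor (a ∷ u ++ [ b ]) w → Factor (c ∷ u ++ [ d ]) w →
  (a ≡ c) ⊎ (a ≡ d) ⊎ (b ≡ c) ⊎ (b ≡ d)

Lα : {k : ℕ} → Fin k → Fin k → List (Fin k)
Lα α x with x ≟ α
... | yes _ = [ α ]
... | no  _ = α ∷ [ x ]

Rα : {k : ℕ} → Fin k → Fin k → List (Fin k)
Rα α x with x ≟ α
... | yes _ = [ α ]
... | no  _ = x ∷ [ α ]

morph* : {A B : Set} → (A → List B) → List A → List B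
morph* φ = concatMap φ

-- w = φ(w') for a non-erasing morphism φ, extended to infinite words:
-- for every n, φ applied to the length-n prefix of w' is a prefix of w.
IsImage : {A : Set} → (A → List A) → InfWord A → InfWord A → Set
IsImage φ w w' = ∀ n → take (length (morph* φ (take n w'))) w ≡ morph* φ (take n w')

-- Let φ be L_α or R_α and w = φ(w'). Every factor of length 2 of φ(w') contains α. Hence, for
-- factors a u b and c u d of w = L_α(w'): if u is empty, each of the pairs ab, cd contains α; if u
-- begins (ends) with a letter other than α, then a = c = α (b = d = α). Otherwise u begins and ends
-- with α, and then u = L_α(u')α for a unique u' such that a u' b and c u' d are factors of w'.
-- Conversely a factor a u b of w' yields the factor a L_α(u)α b of w (look at the image of a u b y).
-- The case φ = R_α reduces to this one through L_α(x)α = αR_α(x): the word αw is L_α(w'), and since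
-- w' is recurrent, αw and w have the same factors.

module Submission where

open import Defs
open import Data.Nat using (ℕ; zero; suc; _+_; _≤_; z≤n; s≤s)
open import Data.Nat.Properties using (+-identityʳ; +-suc; ≤-trans; ≤-reflexive; +-mono-≤)
open import Data.Fin using (Fin; _≟_)
open import Data.List using (List; []; _∷_; _++_; [_]; _∷ʳ_; length)
open import Data.List.Properties
  using ( ++-assoc; ++-identityʳ; ∷ʳ-++; ∷ʳ-injectiveˡ; ∷-injectiveˡ; ∷-injectiveʳ
        ; length-++; concatMap-++)
open import Data.List.Reverse using ([]; _∶_∶ʳ_; reverseView)
open import Data.Product using (∃; ∃₂; _×_; _,_)
open import Data.Sum using (_⊎_; inj₁; inj₂; fromInj₁; fromInj₂)
open import Data.Empty using (⊥-elim)
open import Function using (_∘_; _⇔_; mk⇔)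
open import Function.Properties.Equivalence using () renaming (trans to ⇔-trans)
open import Relation.Nullary using (yes; no)
open import Relation.Binary.PropositionalEquality
  using (_≡_; _≢_; refl; sym; trans; cong; cong₂; subst; module ≡-Reasoning)

Infix : {A : Set} → List A → List A → Set
Infix v l = ∃₂ λ p s → l ≡ p ++ v ++ s

module _ {A : Set} where

  Infix-trans : {u v l : List A} → Infix u v → Infix v l → Infix u l
  Infix-trans {u} (p , s , refl) (q , t , refl) = q ++ p , s ++ t , (begin
    q ++ (p ++ u ++ s) ++ t  ≡⟨ cong (q ++_) (++-assoc p (u ++ s) t) ⟩
    q ++ p ++ (u ++ s) ++ t  ≡⟨ cong (λ z → q ++ p ++ z) (++-assoc u s t) ⟩
    q ++ p ++ u ++ s ++ t    ≡⟨ ++-assoc q p (u ++ s ++ t) ⟨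
    (q ++ p) ++ u ++ s ++ t  ∎)
    where open ≡-Reasoning

  prefix⇒Infix : ∀ (v s : List A) → Infix v (v ++ s)
  prefix⇒Infix v s = [] , s , refl

  Infix-bordered⁺ : ∀ p (a : A) u b s → Infix (a ∷ u ++ [ b ]) (p ++ a ∷ u ++ b ∷ s)
  Infix-bordered⁺ p a u b s = p , s , cong (λ z → p ++ a ∷ z) (sym (++-assoc u [ b ] s))

  Infix-bordered⁻ : ∀ {a : A} {u b l} → Infix (a ∷ u ++ [ b ]) l →
                    ∃₂ λ p s → l ≡ p ++ a ∷ u ++ b ∷ s
  Infix-bordered⁻ {a} {u} {b} (p , s , refl) = p , s , cong (λ z → p ++ a ∷ z) (++-assoc u [ b ] s)

Infix-concatMap : {A B : Set} (φ : A → List B) {v l : List A} →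
                  Infix v l → Infix (morph* φ v) (morph* φ l)
Infix-concatMap φ {v} (p , s , refl) = morph* φ p , morph* φ s ,
  trans (concatMap-++ φ p (v ++ s)) (cong (morph* φ p ++_) (concatMap-++ φ v s))

module _ {A : Set} where

  take-length : ∀ n (w : InfWord A) → length (take n w) ≡ n
  take-length zero    w = refl
  take-length (suc n) w = cong suc (take-length n (w ∘ suc))

  take-+ : ∀ i m (w : InfWord A) → take (i + m) w ≡ take i w ++ take m (dropW i w)
  take-+ zero    m w = refl
  take-+ (suc i) m w = cong (w 0 ∷_) (take-+ i m (w ∘ suc))

  take-suc : ∀ m (w : InfWord A) → take (suc m) w ≡ take m w ∷ʳ w m
  take-suc zero    w = refl
  take-suc (suc m) w = cong (w 0 ∷_) (take-suc m (w ∘ suc))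

  take-cong : ∀ m {f g : InfWord A} → (∀ j → f j ≡ g j) → take m f ≡ take m g
  take-cong zero    f≗g = refl
  take-cong (suc m) f≗g = cong₂ _∷_ (f≗g 0) (take-cong m (f≗g ∘ suc))

  take-mono : ∀ {n m} (w : InfWord A) → n ≤ m → ∃ λ s → take m w ≡ take n w ++ s
  take-mono w z≤n       = take _ w , refl
  take-mono w (s≤s n≤m) with take-mono (w ∘ suc) n≤m
  ... | s , e = s , cong (w 0 ∷_) e

  take-prefix : ∀ n (w : InfWord A) v s → take n w ≡ v ++ s → take (length v) w ≡ v
  take-prefix n       w []      s e = refl
  take-prefix (suc n) w (x ∷ v) s e =
    cong₂ _∷_ (∷-injectiveˡ e) (take-prefix n (w ∘ suc) v s (∷-injectiveʳ e))

  Infix-take⇒OccursAt : ∀ n (w : InfWord A) p v s →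
                        take n w ≡ p ++ v ++ s → OccursAt v w (length p)
  Infix-take⇒OccursAt n       w []      v s e = take-prefix n w v s e
  Infix-take⇒OccursAt (suc n) w (x ∷ p) v s e =
    Infix-take⇒OccursAt n (w ∘ suc) p v s (∷-injectiveʳ e)

  Infix-take⇒Factor : ∀ {n v} {w : InfWord A} → Infix v (take n w) → Factor v w
  Infix-take⇒Factor {n} {v} {w} (p , s , e) = length p , Infix-take⇒OccursAt n w p v s e

  dropW-Infix-take : ∀ i m (w : InfWord A) → Infix (take m (dropW i w)) (take (i + m) w)
  dropW-Infix-take i m w =
    take i w , [] , trans (take-+ i m w) (cong (take i w ++_) (sym (++-identityʳ _)))

  Factor⇒Infix-take : ∀ {v} {w : InfWord A} → Factor v w → ∃ λ n → Infix v (take n w)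
  Factor⇒Infix-take {v} {w} (i , occ) =
    i + length v ,
    subst (λ u → Infix u (take (i + length v) w)) occ (dropW-Infix-take i (length v) w)

  take-Factor : ∀ n (w : InfWord A) → Factor (take n w) w
  take-Factor n w = Infix-take⇒Factor {n = n} ([] , [] , sym (++-identityʳ (take n w)))

  Factor-infix : ∀ {u v} {w : InfWord A} → Infix u v → Factor v w → Factor u w
  Factor-infix {w = w} u⊑v f with Factor⇒Infix-take {w = w} f
  ... | _ , v⊑w = Infix-take⇒Factor (Infix-trans u⊑v v⊑w)

  Factor-extendʳ : ∀ {v} {w : InfWord A} → Factor v w → ∃ λ y → Factor (v ∷ʳ y) w
  Factor-extendʳ {v} {w} (i , occ) = w (i + m) ,
    Infix-take⇒Factor
      (subst (λ u → Infix u (take (i + suc m) w)) next (dropW-Infix-take i (suc m) w))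
    where
    m = length v
    next : take (suc m) (dropW i w) ≡ v ∷ʳ w (i + m)
    next = trans (take-suc m (dropW i w)) (cong (_∷ʳ w (i + m)) occ)

  Factor-extendˡ : ∀ {v} {w : InfWord A} → Recurrent w → Factor v w → ∃ λ y → Factor (y ∷ v) w
  Factor-extendˡ {v} {w} rec f with rec v f 1
  ... | zero  , ()  , _
  ... | suc i , _ , occ = w i , i ,
    cong₂ _∷_ (cong w (+-identityʳ i)) (trans (take-cong (length v) (cong w ∘ +-suc i)) occ)

_∷ʷ_ : {A : Set} → A → InfWord A → InfWord A
(a ∷ʷ w) zero    = a
(a ∷ʷ w) (suc n) = w n

Factor-∷ʷ : {A : Set} {a : A} {w : InfWord A} (v : List A) → Factor v w → Factor v (a ∷ʷ w)
Factor-∷ʷ v (i , occ) = suc i , occ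

module Image {A : Set} (φ : A → List A) (nonErasing : ∀ x → 1 ≤ length (φ x))
             {w w' : InfWord A} (img : IsImage φ w w') where

  length-morph* : ∀ xs → length xs ≤ length (morph* φ xs)
  length-morph* []       = z≤n
  length-morph* (x ∷ xs) =
    ≤-trans (+-mono-≤ (nonErasing x) (length-morph* xs)) (≤-reflexive (sym (length-++ (φ x))))

  ≤-length-image : ∀ n → n ≤ length (morph* φ (take n w'))
  ≤-length-image n =
    subst (_≤ length (morph* φ (take n w'))) (take-length n w') (length-morph* (take n w'))

  Factor⇒Infix-image : ∀ {v} → Factor v w → ∃ λ n → Infix v (morph* φ (take n w'))
  Factor⇒Infix-image f with Factor⇒Infix-take {w = w} f
  ... | n , v⊑w with take-mono w (≤-length-image n)
  ... | s , e = n , Infix-trans v⊑w ([] , s , trans (sym (img n)) e)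

  Infix-image⇒Factor : ∀ {v n} → Infix v (morph* φ (take n w')) → Factor v w
  Infix-image⇒Factor {n = n} v⊑ = Infix-take⇒Factor (subst (Infix _) (sym (img n)) v⊑)

  Factor-morph* : ∀ {v} → Factor v w' → Factor (morph* φ v) w
  Factor-morph* f with Factor⇒Infix-take {w = w'} f
  ... | n , v⊑w' = Infix-image⇒Factor {n = n} (Infix-concatMap φ v⊑w')

PropertyP-antitone : {A : Set} {w₁ w₂ : InfWord A} →
                     (∀ v → Factor v w₁ → Factor v w₂) → PropertyP w₂ → PropertyP w₁
PropertyP-antitone sub P u a b c d f g =
  P u a b c d (sub (a ∷ u ++ [ b ]) f) (sub (c ∷ u ++ [ d ]) g)

common-letter : {A : Set} {α a b c d : A} → a ≡ α ⊎ b ≡ α → c ≡ α ⊎ d ≡ α →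
                (a ≡ c) ⊎ (a ≡ d) ⊎ (b ≡ c) ⊎ (b ≡ d)
common-letter (inj₁ refl) (inj₁ refl) = inj₁ refl
common-letter (inj₁ refl) (inj₂ refl) = inj₂ (inj₁ refl)
common-letter (inj₂ refl) (inj₁ refl) = inj₂ (inj₂ (inj₁ refl))
common-letter (inj₂ refl) (inj₂ refl) = inj₂ (inj₂ (inj₂ refl))

data Shape {A : Set} (α : A) : List A → Set where
  empty      : Shape α []
  head≢α     : ∀ {x u} → x ≢ α → Shape α (x ∷ u)
  last≢α     : ∀ {x u} → x ≢ α → Shape α (u ∷ʳ x)
  α-bordered : ∀ {u₀} u₁ → α ∷ u₀ ≡ u₁ ∷ʳ α → Shape α (α ∷ u₀)

shape : ∀ {k} (α : Fin k) u → Shape α u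
shape α u with reverseView u
... | [] = empty
... | u₁ ∶ _ ∶ʳ x with x ≟ α
...   | no x≢α = last≢α x≢α
...   | yes refl with u₁
...     | [] = α-bordered [] refl
...     | y ∷ u₂ with y ≟ α
...       | no y≢α = head≢α y≢α
...       | yes refl = α-bordered (α ∷ u₂) refl

module Lα-Image {k : ℕ} (α : Fin k) where

  L* : List (Fin k) → List (Fin k)
  L* = morph* (Lα α)

  Lα-ends-with : ∀ x → ∃ λ q → Lα α x ≡ q ∷ʳ x
  Lα-ends-with x with x ≟ α
  ... | yes refl = [] , refl
  ... | no _     = α ∷ [] , refl

  Lα-nonErasing : ∀ x → 1 ≤ length (Lα α x)
  Lα-nonErasing x with x ≟ α
  ... | yes _ = s≤s z≤n
  ... | no _  = s≤s z≤n

  -- The graph of L*, so that L* can be inverted by pattern matching.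
  infix 4 _↦_
  data _↦_ : List (Fin k) → List (Fin k) → Set where
    []  : [] ↦ []
    fix : ∀ {xs ys} → xs ↦ ys → α ∷ xs ↦ α ∷ ys
    ins : ∀ {x xs ys} → x ≢ α → xs ↦ ys → x ∷ xs ↦ α ∷ x ∷ ys

  ↦-complete : ∀ xs → xs ↦ L* xs
  ↦-complete [] = []
  ↦-complete (x ∷ xs) with x ≟ α
  ... | yes refl = fix (↦-complete xs)
  ... | no x≢α   = ins x≢α (↦-complete xs)

  image-head : ∀ {xs y ys} → xs ↦ y ∷ ys → y ≡ α
  image-head (fix _)   = refl
  image-head (ins _ _) = refl

  ↦-functional : ∀ {xs ys ys'} → xs ↦ ys → xs ↦ ys' → ys ≡ ys'
  ↦-functional []          []          = refl
  ↦-functional (fix r)     (fix r')    = cong (α ∷_) (↦-functional r r')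
  ↦-functional (fix r)     (ins α≢α _) = ⊥-elim (α≢α refl)
  ↦-functional (ins α≢α _) (fix r')    = ⊥-elim (α≢α refl)
  ↦-functional (ins _ r)   (ins _ r')  = cong (λ ys → α ∷ _ ∷ ys) (↦-functional r r')

  ↦-injective : ∀ {xs xs' ys} → xs ↦ ys → xs' ↦ ys → xs ≡ xs'
  ↦-injective []          []          = refl
  ↦-injective (fix r)     (fix r')    = cong (α ∷_) (↦-injective r r')
  ↦-injective (fix r)     (ins x≢α _) = ⊥-elim (x≢α (image-head r))
  ↦-injective (ins x≢α _) (fix r')    = ⊥-elim (x≢α (image-head r'))
  ↦-injective (ins _ r)   (ins _ r')  = cong (_ ∷_) (↦-injective r r')

  image-adjacent-α : ∀ p {xs c d s} → xs ↦ p ++ c ∷ d ∷ s → c ≡ α ⊎ d ≡ α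
  image-adjacent-α []          r         = inj₁ (image-head r)
  image-adjacent-α (_ ∷ [])    (ins _ r) = inj₂ (image-head r)
  image-adjacent-α (_ ∷ _ ∷ p) (ins _ r) = image-adjacent-α p r
  image-adjacent-α (_ ∷ p)     (fix r)   = image-adjacent-α p r

  image-pair : ∀ {b y xs ys} → b ∷ y ∷ xs ↦ ys → ∃ λ t → ys ≡ α ∷ b ∷ t
  image-pair (fix (fix _))   = _ , refl
  image-pair (fix (ins _ _)) = _ , refl
  image-pair (ins _ _)       = _ , refl

  preimage-head : ∀ {xs b s} → xs ↦ α ∷ b ∷ s → ∃ λ r → xs ≡ b ∷ r
  preimage-head (fix (fix _))   = _ , refl
  preimage-head (fix (ins _ _)) = _ , refl
  preimage-head (ins _ _)       = _ , refl

  preimage-last : ∀ P {xs a} → xs ↦ P ∷ʳ a → ∃ λ q → xs ≡ q ∷ʳ a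
  preimage-last []          (fix [])   = [] , refl
  preimage-last (_ ∷ [])    (ins _ []) = [] , refl
  preimage-last (_ ∷ _ ∷ P) (ins {x} _ r) with preimage-last P r
  ... | q , refl = x ∷ q , refl
  preimage-last (_ ∷ P) (fix r) with preimage-last P r
  ... | q , refl = α ∷ q , refl

  preimage-cut : ∀ P {xs s} → xs ↦ P ++ α ∷ s →
                 ∃₂ λ xs₁ xs₂ → xs ≡ xs₁ ++ xs₂ × xs₁ ↦ P × xs₂ ↦ α ∷ s
  preimage-cut []       r           = [] , _ , refl , [] , r
  preimage-cut (_ ∷ []) (ins x≢α _) = ⊥-elim (x≢α refl)
  preimage-cut (_ ∷ _ ∷ P) (ins {x} x≢α r) with preimage-cut P r
  ... | xs₁ , xs₂ , refl , r₁ , r₂ = x ∷ xs₁ , xs₂ , refl , ins x≢α r₁ , r₂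
  preimage-cut (_ ∷ P) (fix r) with preimage-cut P r
  ... | xs₁ , xs₂ , refl , r₁ , r₂ = α ∷ xs₁ , xs₂ , refl , fix r₁ , r₂

  preimage-split-after : ∀ p {a xs s} → xs ↦ (p ∷ʳ a) ++ α ∷ s →
                         ∃₂ λ q xs₂ → xs ≡ q ++ a ∷ xs₂ × xs₂ ↦ α ∷ s
  preimage-split-after p {a} r with preimage-cut (p ∷ʳ a) r
  ... | xs₁ , xs₂ , refl , r₁ , r₂ with preimage-last p r₁
  ... | q , refl = q , xs₂ , ∷ʳ-++ q a xs₂ , r₂

  preimage-split-before : ∀ u₁ {b xs s} → xs ↦ u₁ ++ α ∷ b ∷ s →
                          ∃₂ λ u r → xs ≡ u ++ b ∷ r × u ↦ u₁
  preimage-split-before u₁ r with preimage-cut u₁ r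
  ... | u , ys , refl , r₁ , r₂ with preimage-head r₂
  ... | z , refl = u , z , refl , r₁

  L*-injective : ∀ {xs ys} → L* xs ≡ L* ys → xs ≡ ys
  L*-injective {xs} {ys} e =
    ↦-injective (↦-complete xs) (subst (ys ↦_) (sym e) (↦-complete ys))

  L*-adjacent-α : ∀ xs {c d} → Infix (c ∷ [ d ]) (L* xs) → c ≡ α ⊎ d ≡ α
  L*-adjacent-α xs (p , s , e) = image-adjacent-α p (subst (xs ↦_) e (↦-complete xs))

  L*-head≢α : ∀ xs {a x v} → x ≢ α → Infix (a ∷ x ∷ v) (L* xs) → a ≡ α
  L*-head≢α xs {a} {x} {v} x≢α i =
    fromInj₁ (⊥-elim ∘ x≢α) (L*-adjacent-α xs (Infix-trans (prefix⇒Infix (a ∷ [ x ]) v) i))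

  L*-last≢α : ∀ xs {a x v b} → x ≢ α → Infix (a ∷ (v ∷ʳ x) ++ [ b ]) (L* xs) → b ≡ α
  L*-last≢α xs {a} {x} {v} {b} x≢α i =
    fromInj₂ (⊥-elim ∘ x≢α) (L*-adjacent-α xs (Infix-trans x∷b⊑ i))
    where
    x∷b⊑ : Infix (x ∷ [ b ]) (a ∷ (v ∷ʳ x) ++ [ b ])
    x∷b⊑ = a ∷ v , [] , cong (a ∷_) (++-assoc v [ x ] [ b ])

  bordered-image : ∀ a u b y → Infix (a ∷ (L* u ∷ʳ α) ++ [ b ]) (L* (a ∷ u ++ b ∷ [ y ]))
  bordered-image a u b y with Lα-ends-with a | image-pair (↦-complete (b ∷ [ y ]))
  ... | q , ea | t , et = subst (Infix _) (sym image≡) (Infix-bordered⁺ q a (L* u ∷ʳ α) b t)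
    where
    open ≡-Reasoning
    image≡ : L* (a ∷ u ++ b ∷ [ y ]) ≡ q ++ a ∷ (L* u ∷ʳ α) ++ b ∷ t
    image≡ = begin
      Lα α a ++ L* (u ++ b ∷ [ y ])      ≡⟨ cong₂ _++_ ea (concatMap-++ (Lα α) u (b ∷ [ y ])) ⟩
      (q ∷ʳ a) ++ L* u ++ L* (b ∷ [ y ]) ≡⟨ cong (λ z → (q ∷ʳ a) ++ L* u ++ z) et ⟩
      (q ∷ʳ a) ++ L* u ++ α ∷ b ∷ t      ≡⟨ ∷ʳ-++ q a _ ⟩
      q ++ a ∷ L* u ++ α ∷ b ∷ t         ≡⟨ cong (λ z → q ++ a ∷ z) (∷ʳ-++ (L* u) α (b ∷ t)) ⟨
      q ++ a ∷ (L* u ∷ʳ α) ++ b ∷ t      ∎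

  desubstitute : ∀ xs {a b u₀} u₁ → α ∷ u₀ ≡ u₁ ∷ʳ α → Infix (a ∷ (α ∷ u₀) ++ [ b ]) (L* xs) →
                 ∃ λ u → L* u ∷ʳ α ≡ α ∷ u₀ × Infix (a ∷ u ++ [ b ]) xs
  desubstitute xs {a} {b} {u₀} u₁ bordered i with Infix-bordered⁻ {u = α ∷ u₀} i
  ... | p , s , e
    with preimage-split-after p (subst (xs ↦_) (trans e (sym (∷ʳ-++ p a _))) (↦-complete xs))
  ... | q , xs₂ , refl , r₂
    with preimage-split-before u₁
           (subst (xs₂ ↦_) (trans (cong (_++ b ∷ s) bordered) (∷ʳ-++ u₁ α (b ∷ s))) r₂)
  ... | u , z , refl , r =
    u , trans (cong (_∷ʳ α) (sym (↦-functional r (↦-complete u)))) (sym bordered) ,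
    Infix-bordered⁺ q a u b z

  PropertyP-Lα-image : ∀ {w w'} → IsImage (Lα α) w w' → PropertyP w ⇔ PropertyP w'
  PropertyP-Lα-image {w} {w'} img = mk⇔ forth back
    where
    open Image (Lα α) Lα-nonErasing img

    bordered-factor : ∀ {a u b} → Factor (a ∷ u ++ [ b ]) w' → Factor (a ∷ (L* u ∷ʳ α) ++ [ b ]) w
    bordered-factor {a} {u} {b} f with Factor-extendʳ {v = a ∷ u ++ [ b ]} {w = w'} f
    ... | y , fy = Factor-infix {w = w} (bordered-image a u b y) (Factor-morph* fy')
      where
      fy' : Factor (a ∷ u ++ b ∷ [ y ]) w'
      fy' = subst (λ v → Factor v w') (cong (a ∷_) (++-assoc u [ b ] [ y ])) fy

    forth : PropertyP w → PropertyP w'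
    forth P u a b c d f g = P (L* u ∷ʳ α) a b c d (bordered-factor f) (bordered-factor g)

    back : PropertyP w' → PropertyP w
    back P' u a b c d f g
      with Factor⇒Infix-image {a ∷ u ++ [ b ]} f | Factor⇒Infix-image {c ∷ u ++ [ d ]} g
         | shape α u
    ... | n , i | m , j | empty =
      common-letter (L*-adjacent-α (take n w') i) (L*-adjacent-α (take m w') j)
    ... | n , i | m , j | head≢α x≢α =
      inj₁ (trans (L*-head≢α (take n w') x≢α i) (sym (L*-head≢α (take m w') x≢α j)))
    ... | n , i | m , j | last≢α x≢α =
      inj₂ (inj₂ (inj₂
        (trans (L*-last≢α (take n w') x≢α i) (sym (L*-last≢α (take m w') x≢α j)))))
    ... | n , i | m , j | α-bordered u₁ e
      with desubstitute (take n w') u₁ e i | desubstitute (take m w') u₁ e j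
    ... | u' , e' , i' | u'' , e'' , j'
      with L*-injective {u'} {u''} (∷ʳ-injectiveˡ _ _ (trans e' (sym e'')))
    ... | refl = P' u' a b c d (Infix-take⇒Factor {n = n} i') (Infix-take⇒Factor {n = m} j')

module Rα-Image {k : ℕ} (α : Fin k) where
  open Lα-Image α using (L*; Lα-nonErasing; PropertyP-Lα-image)

  R* : List (Fin k) → List (Fin k)
  R* = morph* (Rα α)

  Rα-nonErasing : ∀ x → 1 ≤ length (Rα α x)
  Rα-nonErasing x with x ≟ α
  ... | yes _ = s≤s z≤n
  ... | no _  = s≤s z≤n

  Rα-ends-with-α : ∀ x → ∃ λ q → Rα α x ≡ q ∷ʳ α
  Rα-ends-with-α x with x ≟ α
  ... | yes _ = [] , refl
  ... | no _  = x ∷ [] , refl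

  Lα-∷ʳ-conjugate : ∀ x → Lα α x ∷ʳ α ≡ α ∷ Rα α x
  Lα-∷ʳ-conjugate x with x ≟ α
  ... | yes _ = refl
  ... | no _  = refl

  L*-∷ʳ-conjugate : ∀ xs → L* xs ∷ʳ α ≡ α ∷ R* xs
  L*-∷ʳ-conjugate []       = refl
  L*-∷ʳ-conjugate (x ∷ xs) = begin
    (Lα α x ++ L* xs) ∷ʳ α  ≡⟨ ++-assoc (Lα α x) (L* xs) [ α ] ⟩
    Lα α x ++ L* xs ∷ʳ α    ≡⟨ cong (Lα α x ++_) (L*-∷ʳ-conjugate xs) ⟩
    Lα α x ++ α ∷ R* xs     ≡⟨ ∷ʳ-++ (Lα α x) α (R* xs) ⟨
    (Lα α x ∷ʳ α) ++ R* xs  ≡⟨ cong (_++ R* xs) (Lα-∷ʳ-conjugate x) ⟩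
    α ∷ Rα α x ++ R* xs     ∎
    where open ≡-Reasoning

  L*-Infix-R*-∷ : ∀ y xs → Infix (L* xs) (R* (y ∷ xs))
  L*-Infix-R*-∷ y xs with Rα-ends-with-α y
  ... | q , e = q , [ α ] , (begin
    Rα α y ++ R* xs     ≡⟨ cong (_++ R* xs) e ⟩
    (q ∷ʳ α) ++ R* xs   ≡⟨ ∷ʳ-++ q α (R* xs) ⟩
    q ++ α ∷ R* xs      ≡⟨ cong (q ++_) (L*-∷ʳ-conjugate xs) ⟨
    q ++ L* xs ++ [ α ] ∎)
    where open ≡-Reasoning

  Rα-image⇒Lα-image : ∀ {w w'} → IsImage (Rα α) w w' → IsImage (Lα α) (α ∷ʷ w) w'
  Rα-image⇒Lα-image {w} {w'} img n =
    take-prefix (suc (length (R* t))) (α ∷ʷ w) (L* t) [ α ]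
      (trans (cong (α ∷_) (img n)) (sym (L*-∷ʳ-conjugate t)))
    where t = take n w'

  -- A factor of α ∷ʷ w = L_α(w') lies in L*(t) for a prefix t of w', and L*(t)α = αR*(t) lies in
  -- R*(y t), where y precedes a later occurrence of t in w'.
  Factor-∷ʷ⁻ : ∀ {w w'} → Recurrent w' → IsImage (Rα α) w w' →
               ∀ v → Factor v (α ∷ʷ w) → Factor v w
  Factor-∷ʷ⁻ {w} {w'} rec img v f
    with Image.Factor⇒Infix-image (Lα α) Lα-nonErasing (Rα-image⇒Lα-image img) {v} f
  ... | n , v⊑ with Factor-extendˡ {v = take n w'} {w = w'} rec (take-Factor n w')
  ... | y , f' = Factor-infix {w = w} (Infix-trans v⊑ (L*-Infix-R*-∷ y (take n w')))
                   (Image.Factor-morph* (Rα α) Rα-nonErasing img {y ∷ take n w'} f')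

  PropertyP-∷ʷ : ∀ {w w'} → Recurrent w' → IsImage (Rα α) w w' → PropertyP w ⇔ PropertyP (α ∷ʷ w)
  PropertyP-∷ʷ {w} rec img =
    mk⇔ (PropertyP-antitone {w₁ = α ∷ʷ w} {w₂ = w} (Factor-∷ʷ⁻ rec img))
        (PropertyP-antitone {w₁ = w} {w₂ = α ∷ʷ w} Factor-∷ʷ)

  PropertyP-Rα-image : ∀ {w w'} → Recurrent w' → IsImage (Rα α) w w' → PropertyP w ⇔ PropertyP w'
  PropertyP-Rα-image rec img =
    ⇔-trans (PropertyP-∷ʷ rec img) (PropertyP-Lα-image (Rα-image⇒Lα-image img))

lemma2 : (k : ℕ) (α : Fin k) (w w' : InfWord (Fin k)) →
    Recurrent w → Recurrent w' →
    (IsImage (Lα α) w w' ⊎ IsImage (Rα α) w w') →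
    (PropertyP w ⇔ PropertyP w')
lemma2 k α w w' _ rec' (inj₁ img) = Lα-Image.PropertyP-Lα-image α img
lemma2 k α w w' _ rec' (inj₂ img) = Rα-Image.PropertyP-Rα-image α rec' img
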